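{- Let $\Lambda$ be a connected $k$-graph with $1$-skeleton $E$, and let $S\subset\mathcal{G}(E)\times\mathcal{G}(E)$ be the set of commuting squares of $\Lambda$, namely the pairs $(ef,gh)$ where $ef=gh$ in $\Lambda$ with $d(e)=d(h)=e_i$, $d(f)=d(g)=e_j$ and $i\ne j$. Fix $u\in\Lambda^0$ and, for each $v\in\Lambda^0$, choose $\kappa_v\in v\mathcal{G}(E)u$ with $\kappa_u=u$. Then \[ \pi_1(\Lambda,u)\cong\pi_1(E,u)/K, \] where $K$ is the normal subgroup of $\pi_1(E,u)$ generated by $\{\kappa_{r(\alpha)}^{ -1}\alpha\beta^{ -1}\kappa_{r(\alpha)}:(\alpha,\beta)\in S\}$.
   Context: A $k$-graph is a countable small category with $d:\Lambda\to\mathbb{N}^k$ satisfying unique factorization. $e_1,\dots,e_k$ are the generators of $\mathbb{N}^k$. The $1$-skeleton $E$ is the directed graph with vertices $\Lambda^0$ and edges $\bigsqcup_i d^{ -1}(e_i)$. $\mathcal{G}(E)$ is the fundamental (free) groupoid of $E$, and $\pi_1(E,u)=u\mathcal{G}(E)u$. $\mathcal{G}(\Lambda)$ is the fundamental groupoid of $\Lambda$ (the universal groupoid receiving a functor from $\Lambda$), $\pi_1(\Lambda,u)=u\mathcal{G}(\Lambda)u$, and $\Lambda$ is connected if $\mathcal{G}(\Lambda)$ is connected. -}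

module Defs where

open import Level using (0ℓ)
open import Data.Nat using (ℕ; _+_)
open import Data.Fin using (Fin; _≟_)
open import Data.Vec using (Vec; tabulate; zipWith; replicate)
open import Data.Bool using (if_then_else_)
open import Data.Product using (Σ; _×_; _,_)
open import Relation.Nullary using (¬_; does)
open import Relation.Binary.PropositionalEquality using (_≡_)
open import Relation.Binary using (IsEquivalence)
open import Function.Definitions using (Injective)

_⊕_ : ∀ {k} → Vec ℕ k → Vec ℕ k → Vec ℕ k
_⊕_ = zipWith _+_

𝟎 : ∀ {k} → Vec ℕ k
𝟎 = replicate _ 0

unit : ∀ {k} → Fin k → Vec ℕ k
unit i = tabulate (λ j → if does (i ≟ j) then 1 else 0)

-- k-graphs.  Hom v w = vΛw (range v, source w); μ · ν is defined when
-- s(μ) = r(ν), as in the paper's convention.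

record KGraph (k : ℕ) : Set₁ where
  infixl 7 _·_
  field
    Obj   : Set
    Hom   : Obj → Obj → Set
    idm   : (v : Obj) → Hom v v
    _·_   : ∀ {v w x} → Hom v w → Hom w x → Hom v x
    assoc : ∀ {v w x y} (a : Hom v w) (b : Hom w x) (c : Hom x y) →
            (a · b) · c ≡ a · (b · c)
    idˡ   : ∀ {v w} (a : Hom v w) → idm v · a ≡ a
    idʳ   : ∀ {v w} (a : Hom v w) → a · idm w ≡ a
    -- countable small category
    enc     : Σ Obj (λ v → Σ Obj (λ w → Hom v w)) → ℕ
    enc-inj : Injective _≡_ _≡_ enc
    d     : ∀ {v w} → Hom v w → Vec ℕ k
    d-id  : ∀ v → d (idm v) ≡ 𝟎
    d-·   : ∀ {v w x} (a : Hom v w) (b : Hom w x) → d (a · b) ≡ d a ⊕ d b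
    fact  : ∀ {v x} (l : Hom v x) (m n : Vec ℕ k) → d l ≡ m ⊕ n →
            Σ Obj (λ w → Σ (Hom v w) (λ μ → Σ (Hom w x) (λ ν →
              (d μ ≡ m) × (d ν ≡ n) × (μ · ν ≡ l) ×
              (∀ w' (μ' : Hom v w') (ν' : Hom w' x) →
                 d μ' ≡ m → d ν' ≡ n → μ' · ν' ≡ l →
                 _≡_ {A = Σ Obj (λ z → Hom v z × Hom z x)}
                     (w , μ , ν) (w' , μ' , ν')))))

module _ {k : ℕ} (Λ : KGraph k) where
  open KGraph Λ

  -- The 1-skeleton E: vertices Obj, edges = morphisms of degree some e_i.

  Edge : Obj → Obj → Set
  Edge v w = Σ (Fin k) (λ i → Σ (Hom v w) (λ l → d l ≡ unit i))

  -- The free groupoid G(E): words in edges and inverse edges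
  -- (Word v w = v G(E) w, range v, source w) modulo free reduction.

  data Word : Obj → Obj → Set where
    nil : ∀ {v} → Word v v
    fwd : ∀ {v w x} → Edge v w → Word w x → Word v x   -- e · rest
    bwd : ∀ {v w x} → Edge v w → Word v x → Word w x   -- e⁻¹ · rest

  infixr 5 _++_
  _++_ : ∀ {v w x} → Word v w → Word w x → Word v x
  nil     ++ q = q
  fwd e p ++ q = fwd e (p ++ q)
  bwd e p ++ q = bwd e (p ++ q)

  inv : ∀ {v w} → Word v w → Word w v
  inv nil       = nil
  inv (fwd e p) = inv p ++ bwd e nil
  inv (bwd e p) = inv p ++ fwd e nil

  data _≈ᴱ_ : ∀ {v w} → Word v w → Word v w → Set where
    cancelF : ∀ {v a b x} (p : Word v a) (e : Edge a b) (q : Word a x) →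
              (p ++ fwd e (bwd e q)) ≈ᴱ (p ++ q)
    cancelB : ∀ {v a b x} (p : Word v b) (e : Edge a b) (q : Word b x) →
              (p ++ bwd e (fwd e q)) ≈ᴱ (p ++ q)
    ≈-refl  : ∀ {v w} {p : Word v w} → p ≈ᴱ p
    ≈-sym   : ∀ {v w} {p q : Word v w} → p ≈ᴱ q → q ≈ᴱ p
    ≈-trans : ∀ {v w} {p q r : Word v w} → p ≈ᴱ q → q ≈ᴱ r → p ≈ᴱ r

  record Square (v x : Obj) : Set where
    field
      i j  : Fin k
      i≢j  : ¬ (i ≡ j)
      w₁ w₂ : Obj
      e : Hom v w₁
      f : Hom w₁ x
      g : Hom v w₂
      h : Hom w₂ x
      de : d e ≡ unit i
      df : d f ≡ unit j
      dg : d g ≡ unit j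
      dh : d h ≡ unit i
      comm : e · f ≡ g · h

    α : Word v x
    α = fwd (i , e , de) (fwd (j , f , df) nil)

    β : Word v x
    β = fwd (j , g , dg) (fwd (i , h , dh) nil)

  -- Normal subgroup of π₁(E,u) = Word u u generated by a set R.

  data NormalClosure {u : Obj} (R : Word u u → Set) : Word u u → Set where
    nc-conj : ∀ (g r : Word u u) → R r → NormalClosure R (g ++ r ++ inv g)
    nc-nil  : NormalClosure R nil
    nc-mul  : ∀ {a b} → NormalClosure R a → NormalClosure R b →
              NormalClosure R (a ++ b)
    nc-inv  : ∀ {a} → NormalClosure R a → NormalClosure R (inv a)
    nc-resp : ∀ {a b} → a ≈ᴱ b → NormalClosure R a → NormalClosure R b

  SquareRel : (u : Obj) (κ : (v : Obj) → Word v u) → Word u u → Set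
  SquareRel u κ w =
    Σ Obj (λ v → Σ Obj (λ x → Σ (Square v x) (λ sq →
      w ≡ (inv (κ v) ++ Square.α sq ++ inv (Square.β sq) ++ κ v))))

  -- equality in the quotient group π₁(E,u)/K : x ~ y iff x y⁻¹ ∈ K
  _~[_]_ : ∀ {u} → Word u u → (Word u u → Set) → Word u u → Set
  p ~[ R ] q = NormalClosure R (p ++ inv q)

-- Groupoids (morphism equality is a setoid), Hm v w = morphisms v ← w

record Groupoid (Ob : Set) : Set₁ where
  infixl 7 _∘_
  field
    Hm     : Ob → Ob → Set
    _≈_    : ∀ {v w} → Hm v w → Hm v w → Set
    ≈-eq   : ∀ {v w} → IsEquivalence (_≈_ {v} {w})
    ide    : (v : Ob) → Hm v v
    _∘_    : ∀ {v w x} → Hm v w → Hm w x → Hm v x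
    _⁻¹    : ∀ {v w} → Hm v w → Hm w v
    ∘-cong : ∀ {v w x} {a a' : Hm v w} {b b' : Hm w x} →
             a ≈ a' → b ≈ b' → (a ∘ b) ≈ (a' ∘ b')
    ⁻¹-cong : ∀ {v w} {a a' : Hm v w} → a ≈ a' → (a ⁻¹) ≈ (a' ⁻¹)
    assoc  : ∀ {v w x y} (a : Hm v w) (b : Hm w x) (c : Hm x y) →
             ((a ∘ b) ∘ c) ≈ (a ∘ (b ∘ c))
    idˡ    : ∀ {v w} (a : Hm v w) → (ide v ∘ a) ≈ a
    idʳ    : ∀ {v w} (a : Hm v w) → (a ∘ ide w) ≈ a
    invˡ   : ∀ {v w} (a : Hm v w) → ((a ⁻¹) ∘ a) ≈ ide w
    invʳ   : ∀ {v w} (a : Hm v w) → (a ∘ (a ⁻¹)) ≈ ide v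

record KFunctor {k : ℕ} (Λ : KGraph k) {Ob : Set} (H : Groupoid Ob) : Set where
  open KGraph Λ
  open Groupoid H
  field
    F₀    : Obj → Ob
    F₁    : ∀ {v w} → Hom v w → Hm (F₀ v) (F₀ w)
    F-id  : ∀ v → F₁ (idm v) ≈ ide (F₀ v)
    F-·   : ∀ {v w x} (a : Hom v w) (b : Hom w x) →
            F₁ (a · b) ≈ (F₁ a ∘ F₁ b)

-- The fundamental groupoid G(Λ): a groupoid on the object set Λ⁰ with a
-- functor ι : Λ → G(Λ) (identity on objects), universal among functors
-- from Λ to groupoids.
record FundamentalGroupoid {k : ℕ} (Λ : KGraph k) : Set₁ where
  open KGraph Λ
  field
    G  : Groupoid Obj
  open Groupoid G
  field
    ι     : ∀ {v w} → Hom v w → Hm v w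
    ι-id  : ∀ v → ι (idm v) ≈ ide v
    ι-·   : ∀ {v w x} (a : Hom v w) (b : Hom w x) → ι (a · b) ≈ (ι a ∘ ι b)
    univ  : ∀ {Ob : Set} (H : Groupoid Ob) (F : KFunctor Λ H) →
            let module H = Groupoid H
                module F = KFunctor F in
            Σ (∀ {v w} → Hm v w → H.Hm (F.F₀ v) (F.F₀ w)) (λ Φ →
              (∀ {v w} {a b : Hm v w} → a ≈ b → Φ a H.≈ Φ b) ×
              (∀ v → Φ (ide v) H.≈ H.ide (F.F₀ v)) ×
              (∀ {v w x} (a : Hm v w) (b : Hm w x) →
                 Φ (a ∘ b) H.≈ (Φ a H.∘ Φ b)) ×
              (∀ {v w} (a : Hom v w) → Φ (ι a) H.≈ F.F₁ a) ×
              (∀ (Ψ : ∀ {v w} → Hm v w → H.Hm (F.F₀ v) (F.F₀ w)) →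
                 (∀ v → Ψ (ide v) H.≈ H.ide (F.F₀ v)) →
                 (∀ {v w x} (a : Hm v w) (b : Hm w x) →
                    Ψ (a ∘ b) H.≈ (Ψ a H.∘ Ψ b)) →
                 (∀ {v w} (a : Hom v w) → Ψ (ι a) H.≈ F.F₁ a) →
                 ∀ {v w} (a : Hm v w) → Ψ a H.≈ Φ a))

  -- Λ is connected iff G(Λ) is connected
  Connected : Set
  Connected = ∀ v w → Hm v w

-- Group isomorphism between groups presented as (carrier, setoid
-- equality, multiplication): a multiplicative, well-defined bijection.

record GroupIso {A B : Set} (_≈A_ : A → A → Set) (_∙A_ : A → A → A)
                (_≈B_ : B → B → Set) (_∙B_ : B → B → B) : Set where
  field
    φ      : A → B
    φ-cong : ∀ {x y} → x ≈A y → φ x ≈B φ y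
    φ-hom  : ∀ x y → φ (x ∙A y) ≈B (φ x ∙B φ y)
    φ-inj  : ∀ {x y} → φ x ≈B φ y → x ≈A y
    φ-surj : ∀ b → Σ A (λ a → φ a ≈B b)

module Submission where

open import Defs
open import Data.Nat using (ℕ; zero; suc; _+_) renaming (_≟_ to _≟ℕ_)
open import Data.Nat.Properties using (+-assoc; +-comm; +-identityˡ; +-suc; +-cancelˡ-≡; 0≢1+n; suc-injective)
open import Data.Fin using (Fin; zero; suc) renaming (_≟_ to _≟ᶠ_)
open import Data.Vec using (Vec; []; _∷_; tabulate; sum; tail)
open import Data.Vec.Properties using (≡-dec; zipWith-assoc; zipWith-comm; zipWith-identityˡ; ∷-injective; ∷-injectiveˡ; ∷-injectiveʳ)
open import Data.Product using (Σ; _×_; _,_; proj₁; proj₂)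
open import Data.Empty using (⊥-elim)
open import Data.Sum using (_⊎_; inj₁; inj₂)
open import Relation.Nullary using (¬_; yes; no)
open import Relation.Binary.PropositionalEquality
open import Relation.Binary using (Setoid; IsEquivalence)
open import Axiom.UniquenessOfIdentityProofs using (module Decidable⇒UIP)
import Relation.Binary.Reasoning.Setoid as SetoidReasoning
open import Level using (0ℓ)

-- Let Q = G(E)/⟨S⟩ be the groupoid of words in E modulo free cancellation and the
-- relations α ∼ β for the commuting squares (α, β) ∈ S.  By unique factorisation every morphism of Λ is spelled by a
--     path of edges, and two spellings differ by commuting squares: equal first colours
--     force equal first edges, different first colours complete to a commuting square.
--     Induction is on the total degree.  So spelling is a functor Λ → Q.
--  2. Presentation (Presentation).  The universal property of G(Λ) extends it to
--     toWords : G(Λ) → Q, and evaluating words in G(Λ) is a two-sided inverse: G(Λ) ≅ Q.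
--  3. Vertex groups (VertexGroup).  For loops at u, p ∼ q iff p q⁻¹ ∈ K: the paths κᵥ move
--     every square relation to the base point, and each relator of K is trivial in Q.
-- The isomorphism is toWords on u G(Λ) u.  It exists for every base point and every
-- choice of κ.

module Degree where

  ⊕-assoc : ∀ {k} (a b c : Vec ℕ k) → (a ⊕ b) ⊕ c ≡ a ⊕ (b ⊕ c)
  ⊕-assoc = zipWith-assoc +-assoc

  ⊕-comm : ∀ {k} (a b : Vec ℕ k) → a ⊕ b ≡ b ⊕ a
  ⊕-comm = zipWith-comm +-comm

  ⊕-identityˡ : ∀ {k} (a : Vec ℕ k) → 𝟎 ⊕ a ≡ a
  ⊕-identityˡ = zipWith-identityˡ +-identityˡ

  ⊕-cancelˡ : ∀ {k} (a b c : Vec ℕ k) → a ⊕ b ≡ a ⊕ c → b ≡ c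
  ⊕-cancelˡ []      []      []      _  = refl
  ⊕-cancelˡ (x ∷ a) (y ∷ b) (z ∷ c) eq =
    let x+y≡x+z , b⊕≡c⊕ = ∷-injective eq
    in cong₂ _∷_ (+-cancelˡ-≡ x y z x+y≡x+z) (⊕-cancelˡ a b c b⊕≡c⊕)

  unit-zero-⊕ : ∀ {k} (x : ℕ) (a : Vec ℕ k) → unit zero ⊕ (x ∷ a) ≡ suc x ∷ a
  unit-zero-⊕ x a = cong (suc x ∷_) (trans (cong (_⊕ a) tabulate-0) (⊕-identityˡ a))
    where
    tabulate-0 : ∀ {n} → tabulate {n = n} (λ _ → 0) ≡ 𝟎
    tabulate-0 {zero}  = refl
    tabulate-0 {suc n} = cong (0 ∷_) tabulate-0

  -- A degree containing a generator is nonzero: edge paths are never identities.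
  unit⊕≢𝟎 : ∀ {k} (i : Fin k) (t : Vec ℕ k) → ¬ (unit i ⊕ t ≡ 𝟎)
  unit⊕≢𝟎 zero    (x ∷ t) eq with () ← trans (sym (unit-zero-⊕ x t)) eq
  unit⊕≢𝟎 (suc i) (x ∷ t) eq = unit⊕≢𝟎 i t (cong tail eq)

  ∣_∣ : ∀ {k} → Vec ℕ k → ℕ
  ∣_∣ = sum

  ∣unit⊕∣ : ∀ {k} (i : Fin k) (t : Vec ℕ k) → ∣ unit i ⊕ t ∣ ≡ suc ∣ t ∣
  ∣unit⊕∣ zero    (x ∷ t) = cong ∣_∣ (unit-zero-⊕ x t)
  ∣unit⊕∣ (suc i) (x ∷ t) = trans (cong (x +_) (∣unit⊕∣ i t)) (+-suc x ∣ t ∣)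

  zero-or-unit : ∀ {k} (a : Vec ℕ k) →
                 (a ≡ 𝟎) ⊎ Σ (Fin k) (λ i → Σ (Vec ℕ k) (λ t → a ≡ unit i ⊕ t))
  zero-or-unit []          = inj₁ refl
  zero-or-unit (suc x ∷ a) = inj₂ (zero , x ∷ a , sym (unit-zero-⊕ x a))
  zero-or-unit (zero ∷ a) with zero-or-unit a
  ... | inj₁ a≡𝟎          = inj₁ (cong (0 ∷_) a≡𝟎)
  ... | inj₂ (i , t , a≡) = inj₂ (suc i , 0 ∷ t , cong (0 ∷_) a≡)

  -- If eᵢ + a = eⱼ + b with i ≠ j then eⱼ already occurs in a.  This is what lets two
  -- first edges of different colours be completed to a commuting square.
  unit-split : ∀ {k} (i j : Fin k) → ¬ (i ≡ j) → (a b : Vec ℕ k) →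
               unit i ⊕ a ≡ unit j ⊕ b → Σ (Vec ℕ k) (λ t → a ≡ unit j ⊕ t)
  unit-split zero    zero    i≢j _       _       _  with () ← i≢j refl
  unit-split zero    (suc j) _   (x ∷ a) (y ∷ b) eq =
    x ∷ b , cong (x ∷_) (∷-injectiveʳ (trans (sym (unit-zero-⊕ x a)) eq))
  unit-split (suc i) zero    _   (x ∷ a) (y ∷ b) eq =
    y ∷ a , trans (cong (_∷ a) (∷-injectiveˡ (trans eq (unit-zero-⊕ y b)))) (sym (unit-zero-⊕ y a))
  unit-split (suc i) (suc j) i≢j (x ∷ a) (y ∷ b) eq
    with refl , tails≡ ← ∷-injective eq
    with t , a≡ ← unit-split i j (λ i≡j → i≢j (cong suc i≡j)) a b tails≡
    = x ∷ t , cong (x ∷_) a≡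

module GroupoidFacts {Ob : Set} (H : Groupoid Ob) where
  open Groupoid H

  hom-setoid : Ob → Ob → Setoid 0ℓ 0ℓ
  hom-setoid v w = record { Carrier = Hm v w ; _≈_ = _≈_ ; isEquivalence = ≈-eq }

  module Hom-Reasoning {v w : Ob} = SetoidReasoning (hom-setoid v w)

  open module HomEquivalence {v w : Ob} = IsEquivalence (≈-eq {v} {w}) public
    using () renaming (refl to ≈ₕ-refl; sym to ≈ₕ-sym; trans to ≈ₕ-trans)

  ∘-congˡ : ∀ {v w x} (a : Hm v w) {b b′ : Hm w x} → b ≈ b′ → (a ∘ b) ≈ (a ∘ b′)
  ∘-congˡ a = ∘-cong ≈ₕ-refl

  ∘-congʳ : ∀ {v w x} {a a′ : Hm v w} (b : Hm w x) → a ≈ a′ → (a ∘ b) ≈ (a′ ∘ b)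
  ∘-congʳ b a≈a′ = ∘-cong a≈a′ ≈ₕ-refl

  cancel-inner : ∀ {v w x} (a : Hm v w) (b : Hm w v) (c : Hm v x) →
                 (a ∘ b) ≈ ide v → (a ∘ (b ∘ c)) ≈ c
  cancel-inner a b c ab≈id = ≈ₕ-trans (≈ₕ-sym (assoc a b c)) (≈ₕ-trans (∘-congʳ c ab≈id) (idˡ c))

module _ {Ob Ob′ : Set} (H : Groupoid Ob) (H′ : Groupoid Ob′) where
  private
    module H  = Groupoid H
    module H′ = Groupoid H′

  preserves-inverse : (f₀ : Ob → Ob′) (Φ : ∀ {v w} → H.Hm v w → H′.Hm (f₀ v) (f₀ w)) →
    (∀ {v w} {a b : H.Hm v w} → a H.≈ b → Φ a H′.≈ Φ b) →
    (∀ v → Φ (H.ide v) H′.≈ H′.ide (f₀ v)) →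
    (∀ {v w x} (a : H.Hm v w) (b : H.Hm w x) → Φ (a H.∘ b) H′.≈ (Φ a H′.∘ Φ b)) →
    ∀ {v w} (a : H.Hm v w) → Φ (a H.⁻¹) H′.≈ (Φ a H′.⁻¹)
  preserves-inverse f₀ Φ Φ-cong Φ-ide Φ-∘ {v} {w} a = begin
    Φ (a H.⁻¹)                                ≈⟨ H′.idʳ _ ⟨
    Φ (a H.⁻¹) H′.∘ H′.ide (f₀ v)             ≈⟨ H′.∘-cong ≈ₕ-refl (H′.invʳ (Φ a)) ⟨
    Φ (a H.⁻¹) H′.∘ (Φ a H′.∘ Φ a H′.⁻¹)      ≈⟨ H′.assoc _ _ _ ⟨
    (Φ (a H.⁻¹) H′.∘ Φ a) H′.∘ Φ a H′.⁻¹      ≈⟨ H′.∘-cong (Φ-∘ (a H.⁻¹) a) ≈ₕ-refl ⟨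
    Φ (a H.⁻¹ H.∘ a) H′.∘ Φ a H′.⁻¹           ≈⟨ H′.∘-cong (Φ-cong (H.invˡ a)) ≈ₕ-refl ⟩
    Φ (H.ide w) H′.∘ Φ a H′.⁻¹                ≈⟨ H′.∘-cong (Φ-ide w) ≈ₕ-refl ⟩
    H′.ide (f₀ w) H′.∘ Φ a H′.⁻¹              ≈⟨ H′.idˡ _ ⟩
    Φ a H′.⁻¹                                 ∎
    where
    open GroupoidFacts H′ using (≈ₕ-refl; module Hom-Reasoning)
    open Hom-Reasoning

module Words {k : ℕ} (Λ : KGraph k) where
  open KGraph Λ using (Obj)

  infixr 5 _∙_
  _∙_ : ∀ {v w x} → Word Λ v w → Word Λ w x → Word Λ v x
  _∙_ = _++_ Λ

  infix 8 _⁻¹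
  _⁻¹ : ∀ {v w} → Word Λ v w → Word Λ w v
  _⁻¹ = inv Λ

  infix 4 _≈_
  _≈_ : ∀ {v w} → Word Λ v w → Word Λ v w → Set
  _≈_ = _≈ᴱ_ Λ

  ≈-setoid : Obj → Obj → Setoid 0ℓ 0ℓ
  ≈-setoid v w = record
    { Carrier = Word Λ v w ; _≈_ = _≈_
    ; isEquivalence = record { refl = ≈-refl ; sym = ≈-sym ; trans = ≈-trans } }

  ∙-assoc : ∀ {v w x y} (p : Word Λ v w) (q : Word Λ w x) (r : Word Λ x y) →
            (p ∙ q) ∙ r ≡ p ∙ (q ∙ r)
  ∙-assoc nil       q r = refl
  ∙-assoc (fwd e p) q r = cong (fwd e) (∙-assoc p q r)
  ∙-assoc (bwd e p) q r = cong (bwd e) (∙-assoc p q r)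

  ∙-assoc₃ : ∀ {v w x y z} (a : Word Λ v w) (b : Word Λ w x) (c : Word Λ x y) (r : Word Λ y z) →
             (a ∙ b ∙ c) ∙ r ≡ a ∙ b ∙ c ∙ r
  ∙-assoc₃ a b c r = trans (∙-assoc a (b ∙ c) r) (cong (a ∙_) (∙-assoc b c r))

  ∙-assoc₄ : ∀ {v w x y z t} (a : Word Λ v w) (b : Word Λ w x) (c : Word Λ x y) (d : Word Λ y z)
             (r : Word Λ z t) → (a ∙ b ∙ c ∙ d) ∙ r ≡ a ∙ b ∙ c ∙ d ∙ r
  ∙-assoc₄ a b c d r = trans (∙-assoc a (b ∙ c ∙ d) r) (cong (a ∙_) (∙-assoc₃ b c d r))

  ∙-identityʳ : ∀ {v w} (p : Word Λ v w) → p ∙ nil ≡ p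
  ∙-identityʳ nil       = refl
  ∙-identityʳ (fwd e p) = cong (fwd e) (∙-identityʳ p)
  ∙-identityʳ (bwd e p) = cong (bwd e) (∙-identityʳ p)

  ⁻¹-anti : ∀ {v w x} (p : Word Λ v w) (q : Word Λ w x) → (p ∙ q) ⁻¹ ≡ q ⁻¹ ∙ p ⁻¹
  ⁻¹-anti nil       q = sym (∙-identityʳ (q ⁻¹))
  ⁻¹-anti (fwd e p) q = trans (cong (_∙ bwd e nil) (⁻¹-anti p q)) (∙-assoc (q ⁻¹) (p ⁻¹) _)
  ⁻¹-anti (bwd e p) q = trans (cong (_∙ fwd e nil) (⁻¹-anti p q)) (∙-assoc (q ⁻¹) (p ⁻¹) _)

  ⁻¹-involutive : ∀ {v w} (p : Word Λ v w) → p ⁻¹ ⁻¹ ≡ p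
  ⁻¹-involutive nil       = refl
  ⁻¹-involutive (fwd e p) = trans (⁻¹-anti (p ⁻¹) (bwd e nil)) (cong (fwd e) (⁻¹-involutive p))
  ⁻¹-involutive (bwd e p) = trans (⁻¹-anti (p ⁻¹) (fwd e nil)) (cong (bwd e) (⁻¹-involutive p))

  ≡⇒≈ : ∀ {v w} {p q : Word Λ v w} → p ≡ q → p ≈ q
  ≡⇒≈ refl = ≈-refl

  ≈-∙ʳ : ∀ {v w x} {p q : Word Λ v w} (r : Word Λ w x) → p ≈ q → p ∙ r ≈ q ∙ r
  ≈-∙ʳ r (cancelF p e q) =
    ≈-trans (≡⇒≈ (∙-assoc p _ r)) (≈-trans (cancelF p e (q ∙ r)) (≡⇒≈ (sym (∙-assoc p q r))))
  ≈-∙ʳ r (cancelB p e q) =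
    ≈-trans (≡⇒≈ (∙-assoc p _ r)) (≈-trans (cancelB p e (q ∙ r)) (≡⇒≈ (sym (∙-assoc p q r))))
  ≈-∙ʳ r ≈-refl            = ≈-refl
  ≈-∙ʳ r (≈-sym h)         = ≈-sym (≈-∙ʳ r h)
  ≈-∙ʳ r (≈-trans h h′)    = ≈-trans (≈-∙ʳ r h) (≈-∙ʳ r h′)

  ≈-∙ˡ : ∀ {v w x} (r : Word Λ v w) {p q : Word Λ w x} → p ≈ q → r ∙ p ≈ r ∙ q
  ≈-∙ˡ r (cancelF p e q) =
    ≈-trans (≡⇒≈ (sym (∙-assoc r p _))) (≈-trans (cancelF (r ∙ p) e q) (≡⇒≈ (∙-assoc r p q)))
  ≈-∙ˡ r (cancelB p e q) =
    ≈-trans (≡⇒≈ (sym (∙-assoc r p _))) (≈-trans (cancelB (r ∙ p) e q) (≡⇒≈ (∙-assoc r p q)))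
  ≈-∙ˡ r ≈-refl            = ≈-refl
  ≈-∙ˡ r (≈-sym h)         = ≈-sym (≈-∙ˡ r h)
  ≈-∙ˡ r (≈-trans h h′)    = ≈-trans (≈-∙ˡ r h) (≈-∙ˡ r h′)

  ⁻¹-inverseʳ : ∀ {v w} (p : Word Λ v w) → p ∙ p ⁻¹ ≈ nil
  ⁻¹-inverseʳ nil       = ≈-refl
  ⁻¹-inverseʳ (fwd e p) =
    ≈-trans (≡⇒≈ (cong (fwd e) (sym (∙-assoc p (p ⁻¹) _))))
      (≈-trans (≈-∙ˡ (fwd e nil) (≈-∙ʳ (bwd e nil) (⁻¹-inverseʳ p))) (cancelF nil e nil))
  ⁻¹-inverseʳ (bwd e p) =
    ≈-trans (≡⇒≈ (cong (bwd e) (sym (∙-assoc p (p ⁻¹) _))))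
      (≈-trans (≈-∙ˡ (bwd e nil) (≈-∙ʳ (fwd e nil) (⁻¹-inverseʳ p))) (cancelB nil e nil))

  ⁻¹-inverseˡ : ∀ {v w} (p : Word Λ v w) → p ⁻¹ ∙ p ≈ nil
  ⁻¹-inverseˡ p = ≈-trans (≡⇒≈ (cong (p ⁻¹ ∙_) (sym (⁻¹-involutive p)))) (⁻¹-inverseʳ (p ⁻¹))

  cancelʳ : ∀ {v w x} (p : Word Λ v w) (r : Word Λ v x) → p ∙ (p ⁻¹ ∙ r) ≈ r
  cancelʳ p r = ≈-trans (≡⇒≈ (sym (∙-assoc p (p ⁻¹) r))) (≈-∙ʳ r (⁻¹-inverseʳ p))

  cancelˡ : ∀ {v w x} (p : Word Λ w v) (r : Word Λ v x) → p ⁻¹ ∙ (p ∙ r) ≈ r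
  cancelˡ p r = ≈-trans (≡⇒≈ (sym (∙-assoc (p ⁻¹) p r))) (≈-∙ʳ r (⁻¹-inverseˡ p))

-- The groupoid Q = G(E)/⟨S⟩: words modulo the congruence ∼ generated by free
-- cancellation and by α ∼ β, in any context c ∙ _ ∙ d, for each commuting square (α, β).
module SquareCongruence {k : ℕ} (Λ : KGraph k) where
  open KGraph Λ using (Obj)
  open Words Λ

  infix 4 _∼_
  data _∼_ : ∀ {v x} → Word Λ v x → Word Λ v x → Set where
    free    : ∀ {v x} {p q : Word Λ v x} → p ≈ q → p ∼ q
    square  : ∀ {v a b x} (c : Word Λ v a) (s : Square Λ a b) (d : Word Λ b x) →
              c ∙ Square.α s ∙ d ∼ c ∙ Square.β s ∙ d
    ∼-sym   : ∀ {v x} {p q : Word Λ v x} → p ∼ q → q ∼ p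
    ∼-trans : ∀ {v x} {p q r : Word Λ v x} → p ∼ q → q ∼ r → p ∼ r

  ∼-refl : ∀ {v x} {p : Word Λ v x} → p ∼ p
  ∼-refl = free ≈-refl

  ≡⇒∼ : ∀ {v x} {p q : Word Λ v x} → p ≡ q → p ∼ q
  ≡⇒∼ refl = ∼-refl

  ∼-setoid : Obj → Obj → Setoid 0ℓ 0ℓ
  ∼-setoid v x = record
    { Carrier = Word Λ v x ; _≈_ = _∼_
    ; isEquivalence = record { refl = ∼-refl ; sym = ∼-sym ; trans = ∼-trans } }

  ∼-∙ʳ : ∀ {v w x} {p q : Word Λ v w} (r : Word Λ w x) → p ∼ q → p ∙ r ∼ q ∙ r
  ∼-∙ʳ r (free h)       = free (≈-∙ʳ r h)
  ∼-∙ʳ r (square c s d) =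
    ∼-trans (≡⇒∼ (∙-assoc₃ c (Square.α s) d r))
      (∼-trans (square c s (d ∙ r)) (≡⇒∼ (sym (∙-assoc₃ c (Square.β s) d r))))
  ∼-∙ʳ r (∼-sym h)      = ∼-sym (∼-∙ʳ r h)
  ∼-∙ʳ r (∼-trans h h′) = ∼-trans (∼-∙ʳ r h) (∼-∙ʳ r h′)

  ∼-∙ˡ : ∀ {v w x} (r : Word Λ v w) {p q : Word Λ w x} → p ∼ q → r ∙ p ∼ r ∙ q
  ∼-∙ˡ r (free h)       = free (≈-∙ˡ r h)
  ∼-∙ˡ r (square c s d) =
    ∼-trans (≡⇒∼ (sym (∙-assoc r c _))) (∼-trans (square (r ∙ c) s d) (≡⇒∼ (∙-assoc r c _)))
  ∼-∙ˡ r (∼-sym h)      = ∼-sym (∼-∙ˡ r h)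
  ∼-∙ˡ r (∼-trans h h′) = ∼-trans (∼-∙ˡ r h) (∼-∙ˡ r h′)

  ∼-∙ : ∀ {v w x} {p p′ : Word Λ v w} {q q′ : Word Λ w x} → p ∼ p′ → q ∼ q′ → p ∙ q ∼ p′ ∙ q′
  ∼-∙ {p′ = p′} {q = q} h h′ = ∼-trans (∼-∙ʳ q h) (∼-∙ˡ p′ h′)

  ∼-⁻¹ : ∀ {v w} {p q : Word Λ v w} → p ∼ q → p ⁻¹ ∼ q ⁻¹
  ∼-⁻¹ {v} {w} {p} {q} p∼q = begin
    p ⁻¹                ≈⟨ free (≈-sym (≈-trans (≈-∙ˡ (p ⁻¹) (⁻¹-inverseʳ q)) (≡⇒≈ (∙-identityʳ (p ⁻¹))))) ⟩
    p ⁻¹ ∙ (q ∙ q ⁻¹)   ≈⟨ ∼-∙ˡ (p ⁻¹) (∼-∙ʳ (q ⁻¹) (∼-sym p∼q)) ⟩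
    p ⁻¹ ∙ (p ∙ q ⁻¹)   ≈⟨ free (cancelˡ p (q ⁻¹)) ⟩
    q ⁻¹                ∎
    where open SetoidReasoning (∼-setoid w v)

  quotientGroupoid : Groupoid Obj
  quotientGroupoid = record
    { Hm = Word Λ ; _≈_ = _∼_
    ; ≈-eq = Setoid.isEquivalence (∼-setoid _ _)
    ; ide = λ v → nil ; _∘_ = _∙_ ; _⁻¹ = _⁻¹
    ; ∘-cong = ∼-∙ ; ⁻¹-cong = ∼-⁻¹
    ; assoc = λ p q r → ≡⇒∼ (∙-assoc p q r)
    ; idˡ = λ p → ∼-refl ; idʳ = λ p → ≡⇒∼ (∙-identityʳ p)
    ; invˡ = λ p → free (⁻¹-inverseˡ p) ; invʳ = λ p → free (⁻¹-inverseʳ p) }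

module EdgePaths {k : ℕ} (Λ : KGraph k) where
  open KGraph Λ
  open Degree
  open Words Λ using (_∙_; ∙-assoc)
  open SquareCongruence Λ

  ⟦_⟧ : ∀ {v w} → Edge Λ v w → Hom v w
  ⟦ _ , a , _ ⟧ = a

  factorisation-unique : ∀ {v w w′ x} (μ : Hom v w) (ν : Hom w x) (μ′ : Hom v w′) (ν′ : Hom w′ x) →
    d μ ≡ d μ′ → μ · ν ≡ μ′ · ν′ →
    _≡_ {A = Σ Obj (λ z → Hom v z × Hom z x)} (w , μ , ν) (w′ , μ′ , ν′)
  factorisation-unique {v} {x = x} μ ν μ′ ν′ dμ≡dμ′ μν≡μ′ν′
    with _ , _ , _ , _ , _ , _ , unique ← fact (μ · ν) (d μ) (d ν) (d-· μ ν)
    = trans (sym (unique _ μ ν refl refl refl)) (unique _ μ′ ν′ (sym dμ≡dμ′) dν′≡dν (sym μν≡μ′ν′))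
    where
    dν′≡dν : d ν′ ≡ d ν
    dν′≡dν = ⊕-cancelˡ (d μ) (d ν′) (d ν) (begin
      d μ ⊕ d ν′    ≡⟨ cong (_⊕ d ν′) dμ≡dμ′ ⟩
      d μ′ ⊕ d ν′   ≡⟨ sym (d-· μ′ ν′) ⟩
      d (μ′ · ν′)   ≡⟨ cong d (sym μν≡μ′ν′) ⟩
      d (μ · ν)     ≡⟨ d-· μ ν ⟩
      d μ ⊕ d ν     ∎)
      where open ≡-Reasoning

  edge-degree : ∀ {v w x} (e : Edge Λ v w) {l′ : Hom w x} {l : Hom v x} →
                ⟦ e ⟧ · l′ ≡ l → d l ≡ unit (proj₁ e) ⊕ d l′
  edge-degree (i , a , da) {l′} refl = trans (d-· a l′) (cong (_⊕ d l′) da)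

  edge-∣degree∣ : ∀ {v w x} (e : Edge Λ v w) {l′ : Hom w x} {l : Hom v x} →
                  ⟦ e ⟧ · l′ ≡ l → ∣ d l ∣ ≡ suc ∣ d l′ ∣
  edge-∣degree∣ e {l′} eq = trans (cong ∣_∣ (edge-degree e eq)) (∣unit⊕∣ (proj₁ e) (d l′))

  tail-degree : ∀ {n v w x} (e : Edge Λ v w) {l′ : Hom w x} {l : Hom v x} →
                ⟦ e ⟧ · l′ ≡ l → ∣ d l ∣ ≡ suc n → ∣ d l′ ∣ ≡ n
  tail-degree e el′≡l ∣dl∣≡1+n = suc-injective (trans (sym (edge-∣degree∣ e el′≡l)) ∣dl∣≡1+n)

  data Spells : ∀ {v x} → Word Λ v x → Hom v x → Set where
    nil  : ∀ {v} → Spells nil (idm v)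
    cons : ∀ {v w x} (e : Edge Λ v w) {p : Word Λ w x} {l′ : Hom w x} {l : Hom v x} →
           Spells p l′ → ⟦ e ⟧ · l′ ≡ l → Spells (fwd e p) l

  spells-degree-zero : ∀ {v x} (l : Hom v x) → d l ≡ 𝟎 → Σ (Word Λ v x) (λ p → Spells p l)
  spells-degree-zero {v} {x} l dl≡𝟎 =
    identity (factorisation-unique (idm v) l l (idm x) (trans (d-id v) (sym dl≡𝟎)) (trans (idˡ l) (sym (idʳ l))))
    where
    identity : _≡_ {A = Σ Obj (λ z → Hom v z × Hom z x)} (v , idm v , l) (x , l , idm x) →
               Σ (Word Λ v x) (λ p → Spells p l)
    identity refl = nil , nil

  -- Existence of spellings, by induction on the total degree: split off an edge of any
  -- colour occurring in d l.
  spells-exists : ∀ n {v x} (l : Hom v x) → ∣ d l ∣ ≡ n → Σ (Word Λ v x) (λ p → Spells p l)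
  spells-exists n l ∣dl∣≡n with zero-or-unit (d l)
  ... | inj₁ dl≡𝟎 = spells-degree-zero l dl≡𝟎
  ... | inj₂ (i , t , dl≡) with fact l (unit i) t dl≡ | n
  ...   | _ , a , l′ , da , _ , al′≡l , _ | zero    =
    ⊥-elim (0≢1+n (trans (sym ∣dl∣≡n) (edge-∣degree∣ (i , a , da) al′≡l)))
  ...   | _ , a , l′ , da , _ , al′≡l , _ | suc n′ =
    let p , p-spells = spells-exists n′ l′ (tail-degree (i , a , da) al′≡l ∣dl∣≡n)
    in fwd (i , a , da) p , cons (i , a , da) p-spells al′≡l

  spelling : ∀ {v x} → Hom v x → Word Λ v x
  spelling l = proj₁ (spells-exists _ l refl)

  spelling-spells : ∀ {v x} (l : Hom v x) → Spells (spelling l) l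
  spelling-spells l = proj₂ (spells-exists _ l refl)

  spells-∙ : ∀ {v w x} {p : Word Λ v w} {q : Word Λ w x} {a : Hom v w} {b : Hom w x} →
             Spells p a → Spells q b → Spells (p ∙ q) (a · b)
  spells-∙ {b = b} nil q-spells = subst (Spells _) (sym (idˡ b)) q-spells
  spells-∙ {b = b} (cons e {l′ = l′} p-spells el′≡a) q-spells =
    cons e (spells-∙ p-spells q-spells) (trans (sym (assoc ⟦ e ⟧ l′ b)) (cong (_· b) el′≡a))

  -- Edges are determined by colour and morphism (degrees in ℕᵏ have unique equality proofs).
  edge-≡ : ∀ {v w} (i : Fin k) (a : Hom v w) (da db : d a ≡ unit i) →
           _≡_ {A = Edge Λ v w} (i , a , da) (i , a , db)
  edge-≡ i a da db = cong (λ dx → i , a , dx) (Decidable⇒UIP.≡-irrelevant (≡-dec _≟ℕ_) da db)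

  -- A nonempty edge path never composes to an identity (its degree is nonzero).
  edge-path-not-identity : ∀ {v w} (e : Edge Λ v w) (l′ : Hom w v) → ¬ (⟦ e ⟧ · l′ ≡ idm v)
  edge-path-not-identity {v} e l′ el′≡id = unit⊕≢𝟎 (proj₁ e) (d l′) (trans (sym (edge-degree e el′≡id)) (d-id v))

  UniqueAt : ℕ → Set
  UniqueAt n = ∀ {v x} {l : Hom v x} {p q : Word Λ v x} → ∣ d l ∣ ≡ n → Spells p l → Spells q l → p ∼ q

  -- Two spellings starting with edges of the same colour: by unique factorisation the
  -- first edges agree, and the tails spell the same morphism of smaller degree.
  same-first-edge : ∀ {n v w₁ w₂ x} {l : Hom v x} → UniqueAt n → ∣ d l ∣ ≡ suc n →
    (i : Fin k) (a : Hom v w₁) (b : Hom v w₂) (da : d a ≡ unit i) (db : d b ≡ unit i)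
    {l₁ : Hom w₁ x} {l₂ : Hom w₂ x} {p : Word Λ w₁ x} {q : Word Λ w₂ x} →
    Spells p l₁ → a · l₁ ≡ l → Spells q l₂ → b · l₂ ≡ l → fwd (i , a , da) p ∼ fwd (i , b , db) q
  same-first-edge unique ∣dl∣ i a b da db {l₁} {l₂} p-spells al₁≡l q-spells bl₂≡l
    with refl ← factorisation-unique a l₁ b l₂ (trans da (sym db)) (trans al₁≡l (sym bl₂≡l)) =
    ∼-trans (≡⇒∼ (cong (λ e → fwd e _) (edge-≡ i a da db)))
            (∼-∙ˡ (fwd (i , a , db) nil)
                  (unique (tail-degree (i , a , da) al₁≡l ∣dl∣) p-spells q-spells))

  regroup : ∀ {v y z x} {c : Hom v z} {h : Hom z y} {μ : Hom v y} {ν : Hom y x} {l : Hom v x} →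
            c · h ≡ μ → μ · ν ≡ l → l ≡ c · (h · ν)
  regroup {c = c} {h} {ν = ν} refl refl = assoc c h ν

  record SquareCompletion {v w₁ w₂ x} (i j : Fin k)
         (a : Hom v w₁) (l₁ : Hom w₁ x) (b : Hom v w₂) (l₂ : Hom w₂ x) : Set where
    field
      {y}   : Obj
      f     : Hom w₁ y
      g     : Hom w₂ y
      ν     : Hom y x
      df    : d f ≡ unit j
      dg    : d g ≡ unit i
      comm  : a · f ≡ b · g
      fν≡l₁ : f · ν ≡ l₁
      gν≡l₂ : g · ν ≡ l₂

  -- Two first edges of different colours always complete to a square: factor l at degree
  -- eᵢ + eⱼ, split the initial segment in both orders, and identify the pieces with a, b by
  -- unique factorisation.
  complete-square : ∀ {v w₁ w₂ x} {i j : Fin k} → ¬ (i ≡ j) →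
    (a : Hom v w₁) (l₁ : Hom w₁ x) (b : Hom v w₂) (l₂ : Hom w₂ x) →
    d a ≡ unit i → d b ≡ unit j → a · l₁ ≡ b · l₂ → SquareCompletion i j a l₁ b l₂
  complete-square {i = i} {j} i≢j a l₁ b l₂ da db al₁≡bl₂
    with t , dl₁≡ ← unit-split i j i≢j (d l₁) (d l₂)
                      (trans (sym (edge-degree (i , a , da) refl))
                             (trans (cong d al₁≡bl₂) (edge-degree (j , b , db) refl)))
    with _ , μ , ν , dμ , _ , μν≡al₁ , _ ← fact (a · l₁) (unit i ⊕ unit j) t
           (trans (edge-degree (i , a , da) refl)
                  (trans (cong (unit i ⊕_) dl₁≡) (sym (⊕-assoc (unit i) (unit j) t))))
    with _ , a′ , f , da′ , df , a′f≡μ , _ ← fact μ (unit i) (unit j) dμ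
    with _ , b′ , g , db′ , dg , b′g≡μ , _ ← fact μ (unit j) (unit i) (trans dμ (⊕-comm (unit i) (unit j)))
    with refl ← factorisation-unique a l₁ a′ (f · ν) (trans da (sym da′)) (regroup a′f≡μ μν≡al₁)
       | refl ← factorisation-unique b l₂ b′ (g · ν) (trans db (sym db′))
                  (trans (sym al₁≡bl₂) (regroup b′g≡μ μν≡al₁))
    = record { f = f ; g = g ; ν = ν ; df = df ; dg = dg
             ; comm = trans a′f≡μ (sym b′g≡μ) ; fν≡l₁ = refl ; gν≡l₂ = refl }

  -- Two spellings starting with edges of different colours are related through the
  -- commuting square completing the first edges, followed by any spelling of the tail.
  different-first-edges : ∀ {n v w₁ w₂ x} {l : Hom v x} → UniqueAt n → ∣ d l ∣ ≡ suc n →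
    (i j : Fin k) → ¬ (i ≡ j) → (a : Hom v w₁) (b : Hom v w₂) (da : d a ≡ unit i) (db : d b ≡ unit j)
    {l₁ : Hom w₁ x} {l₂ : Hom w₂ x} {p : Word Λ w₁ x} {q : Word Λ w₂ x} →
    Spells p l₁ → a · l₁ ≡ l → Spells q l₂ → b · l₂ ≡ l →
    SquareCompletion i j a l₁ b l₂ → fwd (i , a , da) p ∼ fwd (j , b , db) q
  different-first-edges {n} {v} {x = x} unique ∣dl∣ i j i≢j a b da db {l₁} {l₂} {p} {q}
                        p-spells al₁≡l q-spells bl₂≡l completion = through-tail (spelling-spells ν)
    where
    open SquareCompletion completion
    S : Square Λ v _
    S = record { i = i ; j = j ; i≢j = i≢j ; e = a ; f = f ; g = b ; h = g
               ; de = da ; df = df ; dg = db ; dh = dg ; comm = comm }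
    through-tail : ∀ {P} → Spells P ν → fwd (i , a , da) p ∼ fwd (j , b , db) q
    through-tail {P} P-spells = begin
      fwd (i , a , da) p                      ≈⟨ ∼-∙ˡ (fwd (i , a , da) nil)
                                                   (unique ∣dl₁∣ p-spells (cons (j , f , df) P-spells fν≡l₁)) ⟩
      fwd (i , a , da) (fwd (j , f , df) P)   ≈⟨ square nil S P ⟩
      fwd (j , b , db) (fwd (i , g , dg) P)   ≈⟨ ∼-∙ˡ (fwd (j , b , db) nil)
                                                   (unique ∣dl₂∣ (cons (i , g , dg) P-spells gν≡l₂) q-spells) ⟩
      fwd (j , b , db) q                      ∎
      where
      open SetoidReasoning (∼-setoid v x)
      ∣dl₁∣ : ∣ d l₁ ∣ ≡ n
      ∣dl₁∣ = tail-degree (i , a , da) al₁≡l ∣dl∣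
      ∣dl₂∣ : ∣ d l₂ ∣ ≡ n
      ∣dl₂∣ = tail-degree (j , b , db) bl₂≡l ∣dl∣

  spells-unique : ∀ n → UniqueAt n
  spells-unique n _ nil nil = ∼-refl
  spells-unique n _ nil (cons e _ el′≡id) = ⊥-elim (edge-path-not-identity e _ el′≡id)
  spells-unique n _ (cons e _ el′≡id) nil = ⊥-elim (edge-path-not-identity e _ el′≡id)
  spells-unique zero ∣dl∣≡0 (cons e _ el′≡l) (cons _ _ _) =
    ⊥-elim (0≢1+n (trans (sym ∣dl∣≡0) (edge-∣degree∣ e el′≡l)))
  spells-unique (suc n) ∣dl∣ (cons (i , a , da) p-spells al₁≡l) (cons (j , b , db) q-spells bl₂≡l)
    with i ≟ᶠ j
  ... | yes refl = same-first-edge (spells-unique n) ∣dl∣ i a b da db p-spells al₁≡l q-spells bl₂≡l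
  ... | no i≢j   = different-first-edges (spells-unique n) ∣dl∣ i j i≢j a b da db p-spells al₁≡l q-spells bl₂≡l
                     (complete-square i≢j a _ b _ da db (trans al₁≡l (sym bl₂≡l)))

  spelling-unique : ∀ {v x} {l : Hom v x} {p : Word Λ v x} → Spells p l → spelling l ∼ p
  spelling-unique {l = l} p-spells = spells-unique _ refl (spelling-spells l) p-spells

  spellingFunctor : KFunctor Λ quotientGroupoid
  spellingFunctor = record
    { F₀ = λ v → v
    ; F₁ = spelling
    ; F-id = λ v → spelling-unique nil
    ; F-· = λ a b → spelling-unique (spells-∙ (spelling-spells a) (spelling-spells b)) }

-- Evaluation kills free cancellation and
-- commuting squares, so it is defined on Q.
module Evaluation {k : ℕ} (Λ : KGraph k) {Ob : Set} (H : Groupoid Ob) (F : KFunctor Λ H) where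
  open KGraph Λ using (Hom; _·_)
  open Groupoid H
  open KFunctor F
  open Words Λ using (_∙_)
  open SquareCongruence Λ using (_∼_; free; square; ∼-sym; ∼-trans)
  open EdgePaths Λ using (⟦_⟧; Spells; nil; cons)
  open GroupoidFacts H

  eval : ∀ {v w} → Word Λ v w → Hm (F₀ v) (F₀ w)
  eval nil       = ide _
  eval (fwd e p) = F₁ ⟦ e ⟧ ∘ eval p
  eval (bwd e p) = (F₁ ⟦ e ⟧ ⁻¹) ∘ eval p

  eval-∙ : ∀ {v w x} (p : Word Λ v w) (q : Word Λ w x) → eval (p ∙ q) ≈ (eval p ∘ eval q)
  eval-∙ nil       q = ≈ₕ-sym (idˡ _)
  eval-∙ (fwd e p) q = ≈ₕ-trans (∘-congˡ _ (eval-∙ p q)) (≈ₕ-sym (assoc _ _ _))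
  eval-∙ (bwd e p) q = ≈ₕ-trans (∘-congˡ _ (eval-∙ p q)) (≈ₕ-sym (assoc _ _ _))

  eval-∙ˡ : ∀ {v w x} (c : Word Λ v w) {m m′ : Word Λ w x} → eval m ≈ eval m′ → eval (c ∙ m) ≈ eval (c ∙ m′)
  eval-∙ˡ c {m} {m′} m≈m′ = ≈ₕ-trans (eval-∙ c m) (≈ₕ-trans (∘-congˡ (eval c) m≈m′) (≈ₕ-sym (eval-∙ c m′)))

  eval-free : ∀ {v w} {p q : Word Λ v w} → _≈ᴱ_ Λ p q → eval p ≈ eval q
  eval-free (cancelF p e q)  = eval-∙ˡ p (cancel-inner _ _ (eval q) (invʳ (F₁ ⟦ e ⟧)))
  eval-free (cancelB p e q)  = eval-∙ˡ p (cancel-inner _ _ (eval q) (invˡ (F₁ ⟦ e ⟧)))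
  eval-free ≈-refl           = ≈ₕ-refl
  eval-free (≈-sym h)        = ≈ₕ-sym (eval-free h)
  eval-free (≈-trans h h′)   = ≈ₕ-trans (eval-free h) (eval-free h′)

  eval-square : ∀ {v w x} (s : Square Λ v w) (d : Word Λ w x) →
                eval (Square.α s ∙ d) ≈ eval (Square.β s ∙ d)
  eval-square s d = begin
    F₁ e ∘ (F₁ f ∘ eval d)    ≈⟨ assoc _ _ _ ⟨
    (F₁ e ∘ F₁ f) ∘ eval d    ≈⟨ ∘-congʳ (eval d) (F-· e f) ⟨
    F₁ (e · f) ∘ eval d       ≡⟨ cong (λ l → F₁ l ∘ eval d) comm ⟩
    F₁ (g · h) ∘ eval d       ≈⟨ ∘-congʳ (eval d) (F-· g h) ⟩
    (F₁ g ∘ F₁ h) ∘ eval d    ≈⟨ assoc _ _ _ ⟩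
    F₁ g ∘ (F₁ h ∘ eval d)    ∎
    where
    open Square s
    open Hom-Reasoning

  eval-∼ : ∀ {v w} {p q : Word Λ v w} → p ∼ q → eval p ≈ eval q
  eval-∼ (free h)        = eval-free h
  eval-∼ (square c s d)  = eval-∙ˡ c (eval-square s d)
  eval-∼ (∼-sym h)       = ≈ₕ-sym (eval-∼ h)
  eval-∼ (∼-trans h h′)  = ≈ₕ-trans (eval-∼ h) (eval-∼ h′)

  eval-spelling : ∀ {v w} {p : Word Λ v w} {l : Hom v w} → Spells p l → eval p ≈ F₁ l
  eval-spelling {v} nil                          = ≈ₕ-sym (F-id v)
  eval-spelling (cons e {l′ = l′} p-spells refl) = ≈ₕ-trans (∘-congˡ _ (eval-spelling p-spells)) (≈ₕ-sym (F-· ⟦ e ⟧ l′))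

module Presentation {k : ℕ} (Λ : KGraph k) (𝒢 : FundamentalGroupoid Λ) where
  open KGraph Λ using (Hom; idʳ)
  open FundamentalGroupoid 𝒢
  open Groupoid G using (Hm; _≈_; _∘_; _⁻¹; ide)
  open GroupoidFacts G using (≈ₕ-refl; ≈ₕ-sym; ≈ₕ-trans)
  open Words Λ using (_∙_)
  open SquareCongruence Λ
  open EdgePaths Λ

  ιFunctor : KFunctor Λ G
  ιFunctor = record { F₀ = λ v → v ; F₁ = ι ; F-id = ι-id ; F-· = ι-· }

  open Evaluation Λ G ιFunctor hiding (eval)
  open Evaluation Λ G ιFunctor public using (eval)

  fixes-ι⇒identity : (Ψ : ∀ {v w} → Hm v w → Hm v w) →
    (∀ v → Ψ (ide v) ≈ ide v) → (∀ {v w x} (a : Hm v w) (b : Hm w x) → Ψ (a ∘ b) ≈ (Ψ a ∘ Ψ b)) →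
    (∀ {v w} (l : Hom v w) → Ψ (ι l) ≈ ι l) → ∀ {v w} (a : Hm v w) → Ψ a ≈ a
  fixes-ι⇒identity Ψ Ψ-ide Ψ-∘ Ψ-ι a
    with _ , _ , _ , _ , _ , unique ← univ G ιFunctor
    = ≈ₕ-trans (unique Ψ Ψ-ide Ψ-∘ Ψ-ι a)
               (≈ₕ-sym (unique (λ b → b) (λ v → ≈ₕ-refl) (λ b c → ≈ₕ-refl) (λ l → ≈ₕ-refl) a))

  toWords : ∀ {v w} → Hm v w → Word Λ v w
  toWords = proj₁ (univ quotientGroupoid spellingFunctor)

  toWords-cong : ∀ {v w} {a b : Hm v w} → a ≈ b → toWords a ∼ toWords b
  toWords-cong = proj₁ (proj₂ (univ quotientGroupoid spellingFunctor))

  toWords-ide : ∀ v → toWords (ide v) ∼ nil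
  toWords-ide = proj₁ (proj₂ (proj₂ (univ quotientGroupoid spellingFunctor)))

  toWords-∘ : ∀ {v w x} (a : Hm v w) (b : Hm w x) → toWords (a ∘ b) ∼ toWords a ∙ toWords b
  toWords-∘ = proj₁ (proj₂ (proj₂ (proj₂ (univ quotientGroupoid spellingFunctor))))

  toWords-ι : ∀ {v w} (l : Hom v w) → toWords (ι l) ∼ spelling l
  toWords-ι = proj₁ (proj₂ (proj₂ (proj₂ (proj₂ (univ quotientGroupoid spellingFunctor)))))

  eval-toWords : ∀ {v w} (a : Hm v w) → eval (toWords a) ≈ a
  eval-toWords = fixes-ι⇒identity (λ a → eval (toWords a))
    (λ v → eval-∼ (toWords-ide v))
    (λ a b → ≈ₕ-trans (eval-∼ (toWords-∘ a b)) (eval-∙ (toWords a) (toWords b)))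
    (λ l → ≈ₕ-trans (eval-∼ (toWords-ι l)) (eval-spelling (spelling-spells l)))

  toWords-injective : ∀ {v w} {a b : Hm v w} → toWords a ∼ toWords b → a ≈ b
  toWords-injective {a = a} {b} φa∼φb =
    ≈ₕ-trans (≈ₕ-sym (eval-toWords a)) (≈ₕ-trans (eval-∼ φa∼φb) (eval-toWords b))

  -- toWords ∘ eval is the identity of Q, checked on generators.
  toWords-edge : ∀ {v w} (e : Edge Λ v w) → toWords (ι ⟦ e ⟧) ∼ fwd e nil
  toWords-edge e = ∼-trans (toWords-ι ⟦ e ⟧) (spelling-unique (cons e nil (idʳ ⟦ e ⟧)))

  toWords-eval : ∀ {v w} (p : Word Λ v w) → toWords (eval p) ∼ p
  toWords-eval {v} nil = toWords-ide v
  toWords-eval (fwd e p) = ∼-trans (toWords-∘ _ (eval p)) (∼-∙ (toWords-edge e) (toWords-eval p))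
  toWords-eval (bwd e p) = ∼-trans (toWords-∘ _ (eval p)) (∼-∙ toWords-edge⁻¹ (toWords-eval p))
    where
    toWords-edge⁻¹ : toWords (ι ⟦ e ⟧ ⁻¹) ∼ bwd e nil
    toWords-edge⁻¹ =
      ∼-trans (preserves-inverse G quotientGroupoid (λ v → v) toWords toWords-cong toWords-ide toWords-∘ (ι ⟦ e ⟧))
              (∼-⁻¹ (toWords-edge e))

module QuotientByNormalClosure {k : ℕ} (Λ : KGraph k) {u : KGraph.Obj Λ} (R : Word Λ u u → Set) where
  open Words Λ

  infix 4 _~ᴿ_
  _~ᴿ_ : Word Λ u u → Word Λ u u → Set
  p ~ᴿ q = _~[_]_ Λ p R q

  ≈⇒~ : ∀ {p q : Word Λ u u} → p ≈ q → p ~ᴿ q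
  ≈⇒~ {p} {q} p≈q = nc-resp (≈-sym (≈-trans (≈-∙ʳ (q ⁻¹) p≈q) (⁻¹-inverseʳ q))) nc-nil

  ~-sym : ∀ {p q : Word Λ u u} → p ~ᴿ q → q ~ᴿ p
  ~-sym {p} {q} pq⁻¹∈N = nc-resp (≡⇒≈ (trans (⁻¹-anti p (q ⁻¹)) (cong (_∙ p ⁻¹) (⁻¹-involutive q)))) (nc-inv pq⁻¹∈N)

  ~-trans : ∀ {p q r : Word Λ u u} → p ~ᴿ q → q ~ᴿ r → p ~ᴿ r
  ~-trans {p} {q} {r} pq⁻¹∈N qr⁻¹∈N =
    nc-resp (≈-trans (≡⇒≈ (∙-assoc p (q ⁻¹) (q ∙ r ⁻¹))) (≈-∙ˡ p (cancelˡ q (r ⁻¹)))) (nc-mul pq⁻¹∈N qr⁻¹∈N)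

module VertexGroup {k : ℕ} (Λ : KGraph k) (u : KGraph.Obj Λ) (κ : (v : KGraph.Obj Λ) → Word Λ v u) where
  open Words Λ
  open SquareCongruence Λ
  open QuotientByNormalClosure Λ (SquareRel Λ u κ)

  K : Word Λ u u → Set
  K = NormalClosure Λ (SquareRel Λ u κ)

  ⁻¹-anti₃ : ∀ {v w x y} (c : Word Λ v w) (m : Word Λ w x) (d : Word Λ x y) →
             (c ∙ m ∙ d) ⁻¹ ≡ d ⁻¹ ∙ m ⁻¹ ∙ c ⁻¹
  ⁻¹-anti₃ c m d = trans (⁻¹-anti c (m ∙ d)) (trans (cong (_∙ c ⁻¹) (⁻¹-anti m d)) (∙-assoc (d ⁻¹) (m ⁻¹) (c ⁻¹)))

  -- Every square relation α β⁻¹ transported to u along any word c lies in K: it is the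
  -- conjugate by c ∙ κᵥ of a defining relator.
  conjugated-square : ∀ {v x} (c : Word Λ u v) (s : Square Λ v x) →
                      K (c ∙ Square.α s ∙ Square.β s ⁻¹ ∙ c ⁻¹)
  conjugated-square {v} {x} c s = nc-resp conjugate≈ (nc-conj (c ∙ κ v) relator (v , x , s , refl))
    where
    open Square s
    relator : Word Λ u u
    relator = κ v ⁻¹ ∙ α ∙ β ⁻¹ ∙ κ v
    conjugate≈ : (c ∙ κ v) ∙ relator ∙ (c ∙ κ v) ⁻¹ ≈ c ∙ α ∙ β ⁻¹ ∙ c ⁻¹
    conjugate≈ = begin
      (c ∙ κ v) ∙ relator ∙ (c ∙ κ v) ⁻¹
        ≡⟨ cong (λ z → (c ∙ κ v) ∙ relator ∙ z) (⁻¹-anti c (κ v)) ⟩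
      (c ∙ κ v) ∙ (κ v ⁻¹ ∙ α ∙ β ⁻¹ ∙ κ v) ∙ (κ v ⁻¹ ∙ c ⁻¹)
        ≡⟨ ∙-assoc c (κ v) _ ⟩
      c ∙ κ v ∙ (κ v ⁻¹ ∙ α ∙ β ⁻¹ ∙ κ v) ∙ (κ v ⁻¹ ∙ c ⁻¹)
        ≡⟨ cong (λ z → c ∙ κ v ∙ z) (∙-assoc₄ (κ v ⁻¹) α (β ⁻¹) (κ v) _) ⟩
      c ∙ κ v ∙ κ v ⁻¹ ∙ α ∙ β ⁻¹ ∙ κ v ∙ κ v ⁻¹ ∙ c ⁻¹
        ≈⟨ ≈-∙ˡ c (cancelʳ (κ v) _) ⟩
      c ∙ α ∙ β ⁻¹ ∙ κ v ∙ κ v ⁻¹ ∙ c ⁻¹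
        ≈⟨ ≈-∙ˡ c (≈-∙ˡ α (≈-∙ˡ (β ⁻¹) (cancelʳ (κ v) (c ⁻¹)))) ⟩
      c ∙ α ∙ β ⁻¹ ∙ c ⁻¹ ∎
      where open SetoidReasoning (≈-setoid u u)

  square-~ : ∀ {v x} (c : Word Λ u v) (s : Square Λ v x) (d : Word Λ x u) →
             c ∙ Square.α s ∙ d ~ᴿ c ∙ Square.β s ∙ d
  square-~ c s d = nc-resp (≈-sym product≈) (conjugated-square c s)
    where
    open Square s
    product≈ : (c ∙ α ∙ d) ∙ (c ∙ β ∙ d) ⁻¹ ≈ c ∙ α ∙ β ⁻¹ ∙ c ⁻¹
    product≈ = begin
      (c ∙ α ∙ d) ∙ (c ∙ β ∙ d) ⁻¹         ≡⟨ cong ((c ∙ α ∙ d) ∙_) (⁻¹-anti₃ c β d) ⟩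
      (c ∙ α ∙ d) ∙ (d ⁻¹ ∙ β ⁻¹ ∙ c ⁻¹)   ≡⟨ ∙-assoc₃ c α d _ ⟩
      c ∙ α ∙ d ∙ d ⁻¹ ∙ β ⁻¹ ∙ c ⁻¹       ≈⟨ ≈-∙ˡ c (≈-∙ˡ α (cancelʳ d _)) ⟩
      c ∙ α ∙ β ⁻¹ ∙ c ⁻¹                  ∎
      where open SetoidReasoning (≈-setoid u u)

  ∼⇒~-in-context : ∀ {v x} {p q : Word Λ v x} → p ∼ q → (c : Word Λ u v) (d : Word Λ x u) →
                   c ∙ p ∙ d ~ᴿ c ∙ q ∙ d
  ∼⇒~-in-context (free p≈q) c d = ≈⇒~ (≈-∙ˡ c (≈-∙ʳ d p≈q))
  ∼⇒~-in-context (square c₀ s d₀) c d =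
    subst₂ _~ᴿ_ (regroup (Square.α s)) (regroup (Square.β s)) (square-~ (c ∙ c₀) s (d₀ ∙ d))
    where
    regroup : ∀ m → (c ∙ c₀) ∙ m ∙ (d₀ ∙ d) ≡ c ∙ (c₀ ∙ m ∙ d₀) ∙ d
    regroup m = trans (∙-assoc c c₀ _) (cong (c ∙_) (sym (∙-assoc₃ c₀ m d₀ d)))
  ∼⇒~-in-context {p = p} {q} (∼-sym h) c d = ~-sym {c ∙ q ∙ d} {c ∙ p ∙ d} (∼⇒~-in-context h c d)
  ∼⇒~-in-context {p = p} {r} (∼-trans {q = q} h h′) c d =
    ~-trans {c ∙ p ∙ d} {c ∙ q ∙ d} {c ∙ r ∙ d} (∼⇒~-in-context h c d) (∼⇒~-in-context h′ c d)

  ∼⇒~ : ∀ {p q : Word Λ u u} → p ∼ q → p ~ᴿ q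
  ∼⇒~ {p} {q} p∼q = subst₂ _~ᴿ_ (∙-identityʳ p) (∙-identityʳ q) (∼⇒~-in-context p∼q nil nil)

  -- Conversely each relator is trivial in Q, by a single square move,
  relator-trivial : ∀ {r : Word Λ u u} → SquareRel Λ u κ r → r ∼ nil
  relator-trivial (v , x , s , refl) = begin
    κ v ⁻¹ ∙ α ∙ β ⁻¹ ∙ κ v    ≈⟨ square (κ v ⁻¹) s (β ⁻¹ ∙ κ v) ⟩
    κ v ⁻¹ ∙ β ∙ β ⁻¹ ∙ κ v    ≈⟨ free (≈-∙ˡ (κ v ⁻¹) (cancelʳ β (κ v))) ⟩
    κ v ⁻¹ ∙ κ v               ≈⟨ free (⁻¹-inverseˡ (κ v)) ⟩
    nil                        ∎
    where
    open Square s
    open SetoidReasoning (∼-setoid u u)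

  closure-trivial : ∀ {r : Word Λ u u} → K r → r ∼ nil
  closure-trivial (nc-conj g r r∈R) =
    ∼-trans (∼-∙ˡ g (∼-∙ʳ (g ⁻¹) (relator-trivial r∈R))) (free (⁻¹-inverseʳ g))
  closure-trivial nc-nil              = ∼-refl
  closure-trivial (nc-mul a∈K b∈K)    = ∼-∙ (closure-trivial a∈K) (closure-trivial b∈K)
  closure-trivial (nc-inv a∈K)        = ∼-⁻¹ (closure-trivial a∈K)
  closure-trivial (nc-resp a≈b a∈K)   = ∼-trans (free (≈-sym a≈b)) (closure-trivial a∈K)

  ~⇒∼ : ∀ {p q : Word Λ u u} → p ~ᴿ q → p ∼ q
  ~⇒∼ {p} {q} pq⁻¹∈K = begin
    p                    ≡⟨ ∙-identityʳ p ⟨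
    p ∙ nil              ≈⟨ free (≈-∙ˡ p (⁻¹-inverseˡ q)) ⟨
    p ∙ (q ⁻¹ ∙ q)       ≡⟨ ∙-assoc p (q ⁻¹) q ⟨
    (p ∙ q ⁻¹) ∙ q       ≈⟨ ∼-∙ʳ q (closure-trivial pq⁻¹∈K) ⟩
    q                    ∎
    where open SetoidReasoning (∼-setoid u u)

-- It is well defined and multiplicative because it is a functor into Q
-- and on loops ∼ is congruence modulo K; it is bijective because eval is its inverse.
mainTheorem19 : ∀ {k : ℕ} (Λ : KGraph k) (𝒢 : FundamentalGroupoid Λ) →
    FundamentalGroupoid.Connected 𝒢 →
    (u : KGraph.Obj Λ) (κ : (v : KGraph.Obj Λ) → Word Λ v u) →
    _≈ᴱ_ Λ (κ u) (nil {v = u}) →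
    GroupIso (Groupoid._≈_ (FundamentalGroupoid.G 𝒢) {u} {u})
    (Groupoid._∘_ (FundamentalGroupoid.G 𝒢) {u} {u} {u})
    (λ p q → _~[_]_ Λ p (SquareRel Λ u κ) q)
    (_++_ Λ {u} {u} {u})
mainTheorem19 Λ 𝒢 _ u κ _ = record
  { φ      = toWords
  ; φ-cong = λ a≈b → ∼⇒~ (toWords-cong a≈b)
  ; φ-hom  = λ a b → ∼⇒~ (toWords-∘ a b)
  ; φ-inj  = λ {a} {b} φa~φb → toWords-injective (~⇒∼ {toWords a} {toWords b} φa~φb)
  ; φ-surj = λ p → eval p , ∼⇒~ (toWords-eval p)
  }
  where
  open Presentation Λ 𝒢
  open VertexGroup Λ u κ
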